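{- Let $k$ be a positive integer, let $c(n,k)$ be defined by $(1-k^2x)^{ -1/k}=\sum_{n\ge 0}c(n,k)x^n$, and let $p$ be a prime not dividing $k$. Write $n=a_0+a_1p+\cdots+a_dp^d$ in base $p$ (digits $0\le a_j\le p-1$), and write the $p$-adic integer $1/k$ as $1/k=1+\sum_{j\ge 0}b_jp^j$ with digits $0\le b_j\le p-1$. Then $p\nmid c(n,k)$ if and only if $a_j+b_j<p$ for all $j$ with $0\le j\le d$.
   Context: Since $p\nmid k$, $k$ is invertible in the ring $\mathbb{Z}_p$ of $p$-adic integers, and $1/k-1\in\mathbb{Z}_p$ has a unique $p$-adic digit expansion $\sum_{j\ge0}b_jp^j$ with $b_j\in\{0,\dots,p-1\}$; these are the $b_j$. -}

module Defs where

open import Data.Nat as ℕ using (ℕ; zero; suc; NonZero)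
open import Data.Integer as ℤ using (ℤ; +_)
open import Data.Rational as ℚ using (ℚ; _/_; 1ℚ; _*_; _-_; -_)

_^ℚ_ : ℚ → ℕ → ℚ
x ^ℚ zero  = 1ℚ
x ^ℚ suc n = x * (x ^ℚ n)

gbinom : ℚ → ℕ → ℚ
gbinom α zero    = 1ℚ
gbinom α (suc n) = gbinom α n * ((α - (+ n / 1)) * (+ 1 / suc n))

-- c(n,k): coefficient of x^n in (1 - k² x)^(-1/k) = Σ_n binom(-1/k, n) (-k² x)^n
c : ℕ → (k : ℕ) → .{{_ : NonZero k}} → ℚ
c n k = gbinom (- (+ 1 / k)) n * ((- (+ (k ℕ.* k) / 1)) ^ℚ n)

sumBelow : ℕ → (ℕ → ℕ) → ℕ
sumBelow zero    f = 0
sumBelow (suc N) f = sumBelow N f ℕ.+ f N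

module Submission where

-- Writing 1/k = 1 + B with B a p-adic integer, the binomial series gives
-- c(n,k) = (-k²)ⁿ binom(-1-B, n) = k²ⁿ binom(B + n, n), so p ∤ c(n,k) iff
-- p ∤ binom(B + n, n), and Kummer's theorem reads this off the base-p digits:
-- no carry occurs when adding the digits of n and of B.

open import Defs
open import Data.Nat as ℕ using (ℕ; NonZero; _<_; _≤_; _+_; _*_; _^_; _∸_; zero; suc; _!; z≤n; s≤s)
open import Data.Nat.Primality using (Prime; euclidsLemma; prime⇒nonZero; prime⇒irreducible; prime⇒nonTrivial)
open import Data.Nat.Divisibility as ND using (_∣_; divides)
open import Data.Integer as ℤ using (ℤ; +_; 1ℤ)
open import Data.Integer.Divisibility as ZD using ()
open import Data.Rational as ℚ using (ℚ; 1ℚ)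
open import Data.Product using (∃; _,_; _×_; proj₁; proj₂)
open import Relation.Binary.PropositionalEquality
open import Relation.Nullary using (¬_; Dec; yes; no)
open import Function.Bundles using (_⇔_; mk⇔)

open import Data.Nat.Coprimality as Cop using (Coprime)
open import Data.Nat.Combinatorics using (_C_; nCk≡n!/k![n-k]!; k![n∸k]!∣n!)
open import Data.Nat.DivMod using (_/_; _%_; m≡m%n+[m/n]*n; m%n<n; m/n<m; m/n*n≡m)
open import Data.Nat.GCD using (module Bézout)
open import Data.Nat.Induction using (<-rec)
open import Data.Nat.ListAction using (product)
open import Data.Nat.Primality.Factorisation using (factorise; PrimeFactorisation)
import Data.Nat.Properties as ℕP
open import Algebra.Properties.CommutativeSemigroup ℕP.*-commutativeSemigroup using (x∙yz≈y∙xz)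
import Data.Integer.Properties as ℤP
import Data.Integer.Divisibility.Signed as ZS
import Data.Rational.Properties as ℚP
import Data.Rational.Unnormalised as ℚᵘ
import Data.Rational.Unnormalised.Properties as ℚᵘP
open import Data.List using ([]; _∷_)
open import Data.List.Relation.Unary.All using (All; []; _∷_)
open import Data.Sum using (inj₁; inj₂)
open import Data.Empty using (⊥-elim)
open import Function.Properties.Equivalence using (⇔-setoid)
open import Function.Related.TypeIsomorphisms using (¬-cong-⇔)
open import Level using (0ℓ)
import Relation.Binary.Reasoning.Setoid as SetoidReasoning
open import Data.Nat.Solver using () renaming (module +-*-Solver to NS)
open import Data.Integer.Solver using () renaming (module +-*-Solver to ZSolver)
open import Data.Rational.Solver using () renaming (module +-*-Solver to QSolver)

module ⇔-Reasoning = SetoidReasoning (⇔-setoid 0ℓ)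

progression : ℕ → ℕ → ℕ
progression k zero    = 1
progression k (suc n) = progression k n * (1 + n * k)

toℚ : ℤ → ℚ
toℚ i = i ℚ./ 1

natℚ : ℕ → ℚ
natℚ m = toℚ (+ m)

toℚᵘ-toℚ : ∀ i → ℚ.toℚᵘ (toℚ i) ℚᵘ.≃ ℚᵘ.mkℚᵘ i 0
toℚᵘ-toℚ i = ℚP.toℚᵘ-fromℚᵘ (ℚᵘ.mkℚᵘ i 0)

toℚ-* : ∀ i j → toℚ (i ℤ.* j) ≡ toℚ i ℚ.* toℚ j
toℚ-* i j = ℚP.toℚᵘ-injective (ℚᵘP.≃-trans (toℚᵘ-toℚ (i ℤ.* j))
  (ℚᵘP.≃-sym (ℚᵘP.≃-trans (ℚP.toℚᵘ-homo-* (toℚ i) (toℚ j))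
    (ℚᵘP.*-cong (toℚᵘ-toℚ i) (toℚᵘ-toℚ j)))))

toℚ-+ : ∀ i j → toℚ (i ℤ.+ j) ≡ toℚ i ℚ.+ toℚ j
toℚ-+ i j = ℚP.toℚᵘ-injective (ℚᵘP.≃-trans (toℚᵘ-toℚ (i ℤ.+ j))
  (ℚᵘP.≃-sym (ℚᵘP.≃-trans (ℚP.toℚᵘ-homo-+ (toℚ i) (toℚ j))
    (ℚᵘP.≃-trans (ℚᵘP.+-cong (toℚᵘ-toℚ i) (toℚᵘ-toℚ j)) (ℚᵘ.*≡* denominators-one)))))
  where
  denominators-one : (i ℤ.* ℤ.1ℤ ℤ.+ j ℤ.* ℤ.1ℤ) ℤ.* ℤ.1ℤ ≡ (i ℤ.+ j) ℤ.* ℤ.1ℤ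
  denominators-one = trans (ℤP.*-identityʳ _)
    (trans (cong₂ ℤ._+_ (ℤP.*-identityʳ i) (ℤP.*-identityʳ j)) (sym (ℤP.*-identityʳ _)))

toℚ-injective : ∀ i j → toℚ i ≡ toℚ j → i ≡ j
toℚ-injective i j eq
  with ℚᵘP.≃-trans (ℚᵘP.≃-sym (toℚᵘ-toℚ i)) (ℚᵘP.≃-trans (ℚP.toℚᵘ-cong eq) (toℚᵘ-toℚ j))
... | ℚᵘ.*≡* e = trans (sym (ℤP.*-identityʳ i)) (trans e (ℤP.*-identityʳ j))

natℚ-* : ∀ m n → natℚ (m * n) ≡ natℚ m ℚ.* natℚ n
natℚ-* m n = trans (cong toℚ (ℤP.pos-* m n)) (toℚ-* (+ m) (+ n))

natℚ-+ : ∀ m n → natℚ (m + n) ≡ natℚ m ℚ.+ natℚ n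
natℚ-+ m n = trans (cong toℚ (ℤP.pos-+ m n)) (toℚ-+ (+ m) (+ n))

natℚ-nonZero : ∀ m → .{{NonZero m}} → ℚ.NonZero (natℚ m)
natℚ-nonZero m = ℚ.≢-nonZero (λ eq → ℕ.≢-nonZero⁻¹ m (ℤP.+-injective (toℚ-injective (+ m) (+ 0) eq)))

ℚ-*-cancelʳ : ∀ x y z .{{_ : ℚ.NonZero z}} → x ℚ.* z ≡ y ℚ.* z → x ≡ y
ℚ-*-cancelʳ x y z eq = begin
  x                          ≡⟨ unscale x ⟨
  x ℚ.* z ℚ.* ℚ.1/ z         ≡⟨ cong (ℚ._* ℚ.1/ z) eq ⟩
  y ℚ.* z ℚ.* ℚ.1/ z         ≡⟨ unscale y ⟩
  y                          ∎
  where
  open ≡-Reasoning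
  unscale : ∀ w → w ℚ.* z ℚ.* ℚ.1/ z ≡ w
  unscale w = trans (ℚP.*-assoc w z (ℚ.1/ z))
    (trans (cong (w ℚ.*_) (ℚP.*-inverseʳ z)) (ℚP.*-identityʳ w))

reciprocal-inverse : ∀ m → (+ 1 ℚ./ suc m) ℚ.* natℚ (suc m) ≡ 1ℚ
reciprocal-inverse m = ℚP.toℚᵘ-injective
  (ℚᵘP.≃-trans (ℚP.toℚᵘ-homo-* (+ 1 ℚ./ suc m) (natℚ (suc m)))
  (ℚᵘP.≃-trans (ℚᵘP.*-cong (ℚP.toℚᵘ-fromℚᵘ (ℚᵘ.mkℚᵘ (+ 1) m)) (toℚᵘ-toℚ (+ suc m)))
  (ℚᵘ.*≡* (cong (λ x → + suc x) (trans (ℕP.*-identityʳ _) (trans (ℕP.+-identityʳ m)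
     (sym (trans (ℕP.+-identityʳ _) (ℕP.*-identityʳ m)))))))))

-- One factor of the product formula:  (-1/k - m) · (-k²) = k (1 + m k).
coefficient-factor : ∀ (u f m : ℚ) → u ℚ.* f ≡ 1ℚ →
  ((ℚ.- u) ℚ.- m) ℚ.* (ℚ.- (f ℚ.* f)) ≡ f ℚ.* (1ℚ ℚ.+ m ℚ.* f)
coefficient-factor u f m uf = begin
  ((ℚ.- u) ℚ.- m) ℚ.* (ℚ.- (f ℚ.* f))
    ≡⟨ solve 3 (λ u f m → ((:- u) :- m) :* (:- (f :* f)) := (u :* f) :* f :+ m :* f :* f) refl u f m ⟩
  (u ℚ.* f) ℚ.* f ℚ.+ m ℚ.* f ℚ.* f
    ≡⟨ cong (λ z → z ℚ.* f ℚ.+ m ℚ.* f ℚ.* f) uf ⟩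
  1ℚ ℚ.* f ℚ.+ m ℚ.* f ℚ.* f
    ≡⟨ solve 2 (λ f m → con 1ℚ :* f :+ m :* f :* f := f :* (con 1ℚ :+ m :* f)) refl f m ⟩
  f ℚ.* (1ℚ ℚ.+ m ℚ.* f) ∎
  where
  open ≡-Reasoning
  open QSolver

-- The product formula  c(n,k) · n! = kⁿ · 1 · (1 + k) ⋯ (1 + (n-1)k), by
-- induction on n: passing from n to n + 1 multiplies the left side by
-- ((-1/k - n)/(n + 1)) · (-k²) · (n + 1) = k (1 + nk).
c-times-factorial : ∀ n k .{{_ : NonZero k}} →
  c n k ℚ.* natℚ (n !) ≡ natℚ (k ^ n * progression k n)
c-times-factorial zero    (suc k) = refl
c-times-factorial (suc n) (suc k) = begin
  c (suc n) k′ ℚ.* natℚ (suc n !)                      ≡⟨ unfold ⟩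
  (c n k′ ℚ.* natℚ (n !)) ℚ.* growth                    ≡⟨ cong₂ ℚ._*_ (c-times-factorial n k′) growth≡ ⟩
  natℚ (k′ ^ n * progression k′ n) ℚ.* natℚ (k′ * (1 + n * k′))
                                                       ≡⟨ natℚ-* (k′ ^ n * progression k′ n) _ ⟨
  natℚ (k′ ^ n * progression k′ n * (k′ * (1 + n * k′)))
    ≡⟨ cong natℚ (NS.solve 4 (λ a b c d → a NS.:* b NS.:* (c NS.:* d) NS.:= c NS.:* a NS.:* (b NS.:* d))
                    refl (k′ ^ n) (progression k′ n) k′ (1 + n * k′)) ⟩
  natℚ (k′ ^ suc n * progression k′ (suc n))           ∎
  where
  open ≡-Reasoning
  open QSolver
  k′ = suc k
  α = ℚ.- (+ 1 ℚ./ k′)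
  inv = + 1 ℚ./ suc n
  K = ℚ.- natℚ (k′ * k′)
  growth = ((α ℚ.- natℚ n) ℚ.* K) ℚ.* (inv ℚ.* natℚ (suc n))
  unfold : c (suc n) k′ ℚ.* natℚ (suc n !) ≡ (c n k′ ℚ.* natℚ (n !)) ℚ.* growth
  unfold = trans (cong (c (suc n) k′ ℚ.*_) (natℚ-* (suc n) (n !)))
    (solve 8 (λ g a m i K Kn N F → (g :* ((a :- m) :* i)) :* (K :* Kn) :* (N :* F)
                                := ((g :* Kn) :* F) :* (((a :- m) :* K) :* (i :* N)))
           refl (gbinom α n) α (natℚ n) inv K (K ^ℚ n) (natℚ (suc n)) (natℚ (n !)))
  growth≡ : growth ≡ natℚ (k′ * (1 + n * k′))
  growth≡ = begin
    growth
      ≡⟨ cong₂ ℚ._*_ (cong (λ z → (α ℚ.- natℚ n) ℚ.* ℚ.- z) (natℚ-* k′ k′)) (reciprocal-inverse n) ⟩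
    ((α ℚ.- natℚ n) ℚ.* ℚ.- (natℚ k′ ℚ.* natℚ k′)) ℚ.* 1ℚ
      ≡⟨ ℚP.*-identityʳ _ ⟩
    (α ℚ.- natℚ n) ℚ.* ℚ.- (natℚ k′ ℚ.* natℚ k′)
      ≡⟨ coefficient-factor (+ 1 ℚ./ k′) (natℚ k′) (natℚ n) (reciprocal-inverse k) ⟩
    natℚ k′ ℚ.* (1ℚ ℚ.+ natℚ n ℚ.* natℚ k′)
      ≡⟨ cong (λ z → natℚ k′ ℚ.* (1ℚ ℚ.+ z)) (natℚ-* n k′) ⟨
    natℚ k′ ℚ.* (natℚ 1 ℚ.+ natℚ (n * k′))
      ≡⟨ cong (natℚ k′ ℚ.*_) (natℚ-+ 1 (n * k′)) ⟨
    natℚ k′ ℚ.* natℚ (1 + n * k′)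
      ≡⟨ natℚ-* k′ (1 + n * k′) ⟨
    natℚ (k′ * (1 + n * k′)) ∎

c-multiple⇔ : ∀ n k .{{_ : NonZero k}} p →
  (∃ λ m → c n k ≡ toℚ (+ p) ℚ.* toℚ m) ⇔ (p * n ! ∣ k ^ n * progression k n)
c-multiple⇔ n k p = mk⇔ to from
  where
  open ≡-Reasoning
  open QSolver
  X = k ^ n * progression k n
  instance
    n!≢0 : ℚ.NonZero (natℚ (n !))
    n!≢0 = natℚ-nonZero (n !) {{n ℕP.!≢0}}

  to : (∃ λ m → c n k ≡ toℚ (+ p) ℚ.* toℚ m) → p * n ! ∣ X
  to (m , eq) = ZS.∣⇒∣ᵤ (ZS.divides m (toℚ-injective (+ X) (m ℤ.* + (p * n !)) (begin
    natℚ X                                 ≡⟨ c-times-factorial n k ⟨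
    c n k ℚ.* natℚ (n !)                   ≡⟨ cong (ℚ._* natℚ (n !)) eq ⟩
    toℚ (+ p) ℚ.* toℚ m ℚ.* natℚ (n !)     ≡⟨ solve 3 (λ P M F → P :* M :* F := M :* (P :* F)) refl (toℚ (+ p)) (toℚ m) (natℚ (n !)) ⟩
    toℚ m ℚ.* (natℚ p ℚ.* natℚ (n !))      ≡⟨ cong (toℚ m ℚ.*_) (natℚ-* p (n !)) ⟨
    toℚ m ℚ.* natℚ (p * n !)               ≡⟨ toℚ-* m (+ (p * n !)) ⟨
    toℚ (m ℤ.* + (p * n !))                ∎)))

  from : p * n ! ∣ X → ∃ λ m → c n k ≡ toℚ (+ p) ℚ.* toℚ m
  from (divides t eq) = + t , ℚ-*-cancelʳ _ _ (natℚ (n !)) (begin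
    c n k ℚ.* natℚ (n !)                   ≡⟨ c-times-factorial n k ⟩
    natℚ X                                 ≡⟨ cong natℚ eq ⟩
    natℚ (t * (p * n !))                   ≡⟨ trans (natℚ-* t _) (cong (natℚ t ℚ.*_) (natℚ-* p (n !))) ⟩
    natℚ t ℚ.* (natℚ p ℚ.* natℚ (n !))     ≡⟨ solve 3 (λ P T F → T :* (P :* F) := P :* T :* F) refl (natℚ p) (natℚ t) (natℚ (n !)) ⟩
    natℚ p ℚ.* natℚ t ℚ.* natℚ (n !)       ∎)

prime>1 : ∀ {p} → Prime p → 1 < p
prime>1 {p} pp = ℕ.nonTrivial⇒n>1 p {{prime⇒nonTrivial pp}}

prime∤1 : ∀ {p} → Prime p → ¬ p ∣ 1
prime∤1 pp p∣1 = ℕP.<⇒≱ (prime>1 pp) (ND.∣⇒≤ p∣1)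

prime-cancel : ∀ {p m n} → Prime p → ¬ p ∣ m → p ∣ m * n → p ∣ n
prime-cancel {m = m} {n} pp p∤m p∣mn with euclidsLemma m n pp p∣mn
... | inj₁ p∣m = ⊥-elim (p∤m p∣m)
... | inj₂ p∣n = p∣n

prime∤* : ∀ {p m n} → Prime p → ¬ p ∣ m → ¬ p ∣ n → ¬ p ∣ m * n
prime∤* pp p∤m p∤n p∣mn = p∤n (prime-cancel pp p∤m p∣mn)

prime∤^ : ∀ {p m} → Prime p → ¬ p ∣ m → ∀ e → ¬ p ∣ m ^ e
prime∤^ pp p∤m zero    = prime∤1 pp
prime∤^ pp p∤m (suc e) = prime∤* pp p∤m (prime∤^ pp p∤m e)

coprime-* : ∀ {a b c} → Coprime a c → Coprime b c → Coprime (a * b) c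
coprime-* {a} {b} {c} a⊥c b⊥c {d} (d∣ab , d∣c) = a⊥c (d∣a , d∣c)
  where
  b⊥d : Coprime b d
  b⊥d (x∣b , x∣d) = b⊥c (x∣b , ND.∣-trans x∣d d∣c)
  d∣a : d ∣ a
  d∣a = Cop.coprime-divisor (Cop.sym b⊥d) (subst (d ∣_) (ℕP.*-comm a b) d∣ab)

prime-power-coprime : ∀ {p m} → Prime p → ¬ p ∣ m → ∀ e → Coprime (p ^ e) m
prime-power-coprime pp p∤m zero    = Cop.1-coprimeTo _
prime-power-coprime pp p∤m (suc e) = coprime-* prime-coprime (prime-power-coprime pp p∤m e)
  where
  prime-coprime : Coprime _ _
  prime-coprime {d} (d∣p , d∣m) with prime⇒irreducible pp d∣p
  ... | inj₁ d≡1 = d≡1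
  ... | inj₂ refl = ⊥-elim (p∤m d∣m)

prime-power-cancel : ∀ {p m n} → Prime p → ¬ p ∣ m → ∀ e → p ^ e ∣ m * n → p ^ e ∣ n
prime-power-cancel pp p∤m e = Cop.coprime-divisor (prime-power-coprime pp p∤m e)

^-monoʳ-∣ : ∀ q {a b} → a ≤ b → q ^ a ∣ q ^ b
^-monoʳ-∣ q {a} {b} a≤b = divides (q ^ (b ∸ a)) (begin
  q ^ b               ≡⟨ cong (q ^_) (ℕP.m+[n∸m]≡n a≤b) ⟨
  q ^ (a + (b ∸ a))   ≡⟨ ℕP.^-distribˡ-+-* q a (b ∸ a) ⟩
  q ^ a * q ^ (b ∸ a) ≡⟨ ℕP.*-comm (q ^ a) _ ⟩
  q ^ (b ∸ a) * q ^ a ∎)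
  where open ≡-Reasoning

^-monoˡ-∣ : ∀ {a b} → a ∣ b → ∀ m → a ^ m ∣ b ^ m
^-monoˡ-∣ a∣b zero    = ND.∣-refl
^-monoˡ-∣ a∣b (suc m) = ND.*-pres-∣ a∣b (^-monoˡ-∣ a∣b m)

-- The r < p factors pX + 1, …, pX + r are all prime to p:
-- (pX + r)! = (pX)! · W with p ∤ W.
factorial-tail : ∀ {p} → Prime p → ∀ X r → r < p →
  ∃ λ W → ¬ p ∣ W × (p * X + r) ! ≡ (p * X) ! * W
factorial-tail {p} pp X zero    _   = 1 , prime∤1 pp ,
  trans (cong _! (ℕP.+-identityʳ (p * X))) (sym (ℕP.*-identityʳ _))
factorial-tail {p} pp X (suc r) r<p with factorial-tail pp X r (ℕP.<-trans (ℕP.n<1+n r) r<p)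
... | W , p∤W , eq = suc (p * X + r) * W , prime∤* pp p∤next p∤W , (begin
  (p * X + suc r) !                ≡⟨ cong _! (ℕP.+-suc (p * X) r) ⟩
  suc (p * X + r) * (p * X + r) !  ≡⟨ cong (suc (p * X + r) *_) eq ⟩
  suc (p * X + r) * ((p * X) ! * W) ≡⟨ x∙yz≈y∙xz (suc (p * X + r)) ((p * X) !) W ⟩
  (p * X) ! * (suc (p * X + r) * W) ∎)
  where
  open ≡-Reasoning
  p∤next : ¬ p ∣ suc (p * X + r)
  p∤next p∣ = ℕP.<⇒≱ r<p (ND.∣⇒≤ (ND.∣m+n∣m⇒∣n (subst (p ∣_) (sym (ℕP.+-suc (p * X) r)) p∣) (ND.m∣m*n X)))

-- (pX)! = p^X · X! · W with p ∤ W: the multiples p, 2p, …, Xp contribute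
-- p^X · X!, all other factors are prime to p.
factorial-multiple : ∀ {p} → Prime p → ∀ X → ∃ λ W → ¬ p ∣ W × (p * X) ! ≡ p ^ X * X ! * W
factorial-multiple {p} pp zero = 1 , prime∤1 pp , cong _! (ℕP.*-zeroʳ p)
factorial-multiple {suc q} pp (suc X) with factorial-multiple pp X | factorial-tail pp X q ℕP.≤-refl
... | W₀ , p∤W₀ , eq₀ | W₁ , p∤W₁ , eq₁ = W₀ * W₁ , prime∤* pp p∤W₀ p∤W₁ , (begin
  (p * suc X) !                              ≡⟨ cong _! p[X+1]≡ ⟩
  suc (p * X + q) * (p * X + q) !            ≡⟨ cong (suc (p * X + q) *_) (trans eq₁ (cong (_* W₁) eq₀)) ⟩
  suc (p * X + q) * (p ^ X * X ! * W₀ * W₁)  ≡⟨ cong (_* (p ^ X * X ! * W₀ * W₁)) p[X+1]≡ ⟨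
  p * suc X * (p ^ X * X ! * W₀ * W₁)        ≡⟨ NS.solve 6 (λ p x a b c d → p NS.:* (NS.con 1 NS.:+ x) NS.:* (a NS.:* b NS.:* c NS.:* d)
                                                   NS.:= p NS.:* a NS.:* ((NS.con 1 NS.:+ x) NS.:* b) NS.:* (c NS.:* d))
                                                 refl p X (p ^ X) (X !) W₀ W₁ ⟩
  p ^ suc X * suc X ! * (W₀ * W₁)            ∎)
  where
  open ≡-Reasoning
  p = suc q
  p[X+1]≡ : p * suc X ≡ suc (p * X + q)
  p[X+1]≡ = trans (ℕP.*-suc p X) (trans (ℕP.+-comm p (p * X)) (ℕP.+-suc (p * X) q))

factorial-split : ∀ {p} → Prime p → ∀ X r → r < p → ∃ λ W → ¬ p ∣ W × (p * X + r) ! ≡ p ^ X * X ! * W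
factorial-split {p} pp X r r<p with factorial-multiple pp X | factorial-tail pp X r r<p
... | W₀ , p∤W₀ , eq₀ | W₁ , p∤W₁ , eq₁ = W₀ * W₁ , prime∤* pp p∤W₀ p∤W₁ ,
  trans eq₁ (trans (cong (_* W₁) eq₀) (ℕP.*-assoc (p ^ X * X !) W₀ W₁))

-- p^e ∣ n! forces e ≤ n  (a crude form of Legendre's formula v_p(n!) ≤ n):
-- by strong induction, writing n = pX + r and using 2X ≤ n.
factorial-valuation-bound : ∀ {p} → Prime p → ∀ n e → p ^ e ∣ n ! → e ≤ n
factorial-valuation-bound {p} pp = <-rec (λ n → ∀ e → p ^ e ∣ n ! → e ≤ n) bound
  where
  bound : ∀ n → (∀ {m} → m < n → ∀ e → p ^ e ∣ m ! → e ≤ m) → ∀ e → p ^ e ∣ n ! → e ≤ n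
  bound zero    _ zero    _      = z≤n
  bound zero    _ (suc e) p^e∣1 = ⊥-elim (prime∤1 pp (ND.∣-trans (ND.m∣m*n (p ^ e)) p^e∣1))
  bound n@(suc _) rec e p^e∣n! = by-cases (e ℕP.≤? X)
    where
    instance
      p≢0 : NonZero p
      p≢0 = prime⇒nonZero pp
    X = n / p
    r = n % p
    n≡pX+r : n ≡ p * X + r
    n≡pX+r = trans (m≡m%n+[m/n]*n n p) (trans (ℕP.+-comm r (X * p)) (cong (_+ r) (ℕP.*-comm X p)))
    split = factorial-split pp X r (m%n<n n p)
    p^e∣p^X*X! : p ^ e ∣ p ^ X * X !
    p^e∣p^X*X! = prime-power-cancel pp (proj₁ (proj₂ split)) e
      (subst (p ^ e ∣_) (trans (cong _! n≡pX+r) (trans (proj₂ (proj₂ split)) (ℕP.*-comm (p ^ X * X !) (proj₁ split)))) p^e∣n!)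
    X<n : X < n
    X<n = m/n<m n p (prime>1 pp)
    2X≤n : X + X ≤ n
    2X≤n = begin
      X + X       ≡⟨ cong (_+_ X) (ℕP.+-identityʳ X) ⟨
      2 * X       ≤⟨ ℕP.*-monoˡ-≤ X (prime>1 pp) ⟩
      p * X       ≤⟨ ℕP.m≤m+n (p * X) r ⟩
      p * X + r   ≡⟨ n≡pX+r ⟨
      n           ∎
      where open ℕP.≤-Reasoning
    by-cases : Dec (e ≤ X) → e ≤ n
    by-cases (yes e≤X) = ℕP.≤-trans e≤X (ℕP.<⇒≤ X<n)
    by-cases (no e≰X) = begin
      e             ≡⟨ ℕP.m+[n∸m]≡n X≤e ⟨
      X + (e ∸ X)   ≤⟨ ℕP.+-monoʳ-≤ X (rec X<n (e ∸ X) p^[e-X]∣X!) ⟩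
      X + X         ≤⟨ 2X≤n ⟩
      n             ∎
      where
      open ℕP.≤-Reasoning
      X≤e : X ≤ e
      X≤e = ℕP.<⇒≤ (ℕP.≰⇒> e≰X)
      p^[e-X]∣X! : p ^ (e ∸ X) ∣ X !
      p^[e-X]∣X! = ND.*-cancelˡ-∣ (p ^ X) {{ℕP.m^n≢0 p X}}
        (subst (_∣ p ^ X * X !) (trans (cong (p ^_) (sym (ℕP.m+[n∸m]≡n X≤e))) (ℕP.^-distribˡ-+-* p X (e ∸ X))) p^e∣p^X*X!)

binomial-identity : ∀ {m k} → k ≤ m → (m C k) * (k ! * (m ∸ k) !) ≡ m !
binomial-identity {m} {k} k≤m =
  trans (cong (_* (k ! * (m ∸ k) !)) (nCk≡n!/k![n-k]! k≤m))
        (m/n*n≡m {{k ℕP.!* (m ∸ k) !≢0}} (k![n∸k]!∣n! k≤m))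

binomial-sum-identity : ∀ B n → ((B + n) C n) * (n ! * B !) ≡ (B + n) !
binomial-sum-identity B n = trans (cong (λ x → ((B + n) C n) * (n ! * x !)) (sym (ℕP.m+n∸n≡m B n)))
  (binomial-identity (ℕP.m≤n+m n B))

rising : ℕ → ℕ → ℕ
rising M zero    = 1
rising M (suc n) = rising M n * (M + n)

rising-factorial : ∀ B n → rising (suc B) n * B ! ≡ (B + n) !
rising-factorial B zero    = trans (ℕP.*-identityˡ (B !)) (cong _! (sym (ℕP.+-identityʳ B)))
rising-factorial B (suc n) = begin
  rising (suc B) n * (suc B + n) * B !   ≡⟨ NS.solve 3 (λ a b c → a NS.:* b NS.:* c NS.:= b NS.:* (a NS.:* c))
                                                refl (rising (suc B) n) (suc B + n) (B !) ⟩
  (suc B + n) * (rising (suc B) n * B !) ≡⟨ cong ((suc B + n) *_) (rising-factorial B n) ⟩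
  (suc B + n) * (B + n) !                ≡⟨ cong _! (ℕP.+-suc B n) ⟨
  (B + suc n) !                          ∎
  where open ≡-Reasoning

rising-binomial : ∀ B n → rising (suc B) n ≡ ((B + n) C n) * n !
rising-binomial B n = ℕP.*-cancelʳ-≡ _ _ (B !) {{B ℕP.!≢0}} (begin
  rising (suc B) n * B !        ≡⟨ rising-factorial B n ⟩
  (B + n) !                     ≡⟨ binomial-sum-identity B n ⟨
  ((B + n) C n) * (n ! * B !)   ≡⟨ ℕP.*-assoc ((B + n) C n) (n !) (B !) ⟨
  ((B + n) C n) * n ! * B !     ∎)
  where open ≡-Reasoning

factorial∣rising : ∀ M n → n ! ∣ rising M n
factorial∣rising (suc B) n = divides ((B + n) C n) (rising-binomial B n)
factorial∣rising zero zero    = ND.∣-refl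
factorial∣rising zero (suc n) = subst (suc n ! ∣_) (sym (rising-zero n)) (ND._∣0 _)
  where
  rising-zero : ∀ n → rising 0 (suc n) ≡ 0
  rising-zero zero    = refl
  rising-zero (suc n) = cong (_* suc n) (rising-zero n)

-- If kM ≡ 1 (mod Q) then 1 + ik ≡ k (M + i) termwise, hence
-- ∏ᵢ (1 + ik) ≡ kⁿ M (M + 1) ⋯ (M + n - 1)  (mod Q).
progression≡rising : ∀ (Q : ℤ) k M → Q ZS.∣ (+ k ℤ.* + M ℤ.- 1ℤ) →
  ∀ n → Q ZS.∣ (+ progression k n ℤ.- + (k ^ n * rising M n))
progression≡rising Q k M Q∣kM-1 zero = subst (Q ZS.∣_) (sym (ℤP.+-inverseʳ 1ℤ)) (ZS.divides (+ 0) refl)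
progression≡rising Q k M Q∣kM-1 (suc n) = subst (Q ZS.∣_) (sym next-difference)
  (ZS.∣m∣n⇒∣m-n (ZS.∣m⇒∣m*n (1ℤ ℤ.+ + n ℤ.* + k) (progression≡rising Q k M Q∣kM-1 n)) (ZS.∣n⇒∣m*n y Q∣kM-1))
  where
  open ZSolver
  x = + progression k n
  y = + (k ^ n * rising M n)
  x-next : + progression k (suc n) ≡ x ℤ.* (1ℤ ℤ.+ + n ℤ.* + k)
  x-next = trans (ℤP.pos-* (progression k n) (1 + n * k))
    (cong (x ℤ.*_) (trans (ℤP.pos-+ 1 (n * k)) (cong (λ z → 1ℤ ℤ.+ z) (ℤP.pos-* n k))))
  y-next : + (k ^ suc n * rising M (suc n)) ≡ y ℤ.* (+ k ℤ.* (+ M ℤ.+ + n))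
  y-next = trans (cong +_ (NS.solve 4 (λ a b c d → a NS.:* b NS.:* (c NS.:* d) NS.:= b NS.:* c NS.:* (a NS.:* d))
                           refl k (k ^ n) (rising M n) (M + n)))
    (trans (ℤP.pos-* (k ^ n * rising M n) (k * (M + n)))
      (cong (y ℤ.*_) (trans (ℤP.pos-* k (M + n)) (cong (+ k ℤ.*_) (ℤP.pos-+ M n)))))
  next-difference : + progression k (suc n) ℤ.- + (k ^ suc n * rising M (suc n))
    ≡ (x ℤ.- y) ℤ.* (1ℤ ℤ.+ + n ℤ.* + k) ℤ.- y ℤ.* (+ k ℤ.* + M ℤ.- 1ℤ)
  next-difference = trans (cong₂ ℤ._-_ x-next y-next)
    (solve 5 (λ x y n k m → x :* (con 1ℤ :+ n :* k) :- y :* (k :* (m :+ n))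
                         := (x :- y) :* (con 1ℤ :+ n :* k) :- y :* (k :* m :- con 1ℤ))
           refl x y (+ n) (+ k) (+ M))

-- k is invertible modulo every power of a prime q ∤ k (Bézout); the inverse
-- is taken in ℕ, squaring kx ≡ -1 when Bézout produces the negative form.
inverse-mod-prime-power : ∀ {q k} → Prime q → ¬ q ∣ k → ∀ e →
  ∃ λ U → + (q ^ e) ZS.∣ (+ k ℤ.* + U ℤ.- 1ℤ)
inverse-mod-prime-power {q} {k} pq q∤k e with Cop.coprime-Bézout (Cop.sym (prime-power-coprime pq q∤k e))
... | Bézout.+- x y eq = x , ZS.divides (+ y) (begin
  + k ℤ.* + x ℤ.- 1ℤ        ≡⟨ cong (ℤ._- 1ℤ) (trans (sym (ℤP.pos-* k x)) (cong +_ (trans (ℕP.*-comm k x) (sym eq)))) ⟩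
  + (1 + y * Q) ℤ.- 1ℤ      ≡⟨ cong (ℤ._- 1ℤ) (trans (ℤP.pos-+ 1 (y * Q)) (ℤP.+-comm 1ℤ (+ (y * Q)))) ⟩
  + (y * Q) ℤ.+ 1ℤ ℤ.- 1ℤ   ≡⟨ ZSolver.solve 2 (λ a b → a ZSolver.:+ b ZSolver.:- b ZSolver.:= a) refl (+ (y * Q)) 1ℤ ⟩
  + (y * Q)                 ≡⟨ ℤP.pos-* y Q ⟩
  + y ℤ.* + Q               ∎)
  where
  open ≡-Reasoning
  Q = q ^ e
... | Bézout.-+ x y eq = x * (k * x) , ZS.divides ((+ k ℤ.* + x ℤ.- 1ℤ) ℤ.* + y) (begin
  + k ℤ.* + (x * (k * x)) ℤ.- 1ℤ          ≡⟨ cong (λ z → + k ℤ.* z ℤ.- 1ℤ) (trans (ℤP.pos-* x (k * x)) (cong (+ x ℤ.*_) (ℤP.pos-* k x))) ⟩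
  + k ℤ.* (+ x ℤ.* (+ k ℤ.* + x)) ℤ.- 1ℤ  ≡⟨ solve 2 (λ k x → k :* (x :* (k :* x)) :- con 1ℤ := (k :* x :- con 1ℤ) :* (k :* x :+ con 1ℤ)) refl (+ k) (+ x) ⟩
  (kx ℤ.- 1ℤ) ℤ.* (kx ℤ.+ 1ℤ)             ≡⟨ cong ((kx ℤ.- 1ℤ) ℤ.*_) kx+1≡yQ ⟩
  (kx ℤ.- 1ℤ) ℤ.* (+ y ℤ.* + Q)           ≡⟨ ℤP.*-assoc (kx ℤ.- 1ℤ) (+ y) (+ Q) ⟨
  (kx ℤ.- 1ℤ) ℤ.* + y ℤ.* + Q             ∎)
  where
  open ≡-Reasoning
  open ZSolver
  Q = q ^ e
  kx = + k ℤ.* + x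
  kx+1≡yQ : kx ℤ.+ 1ℤ ≡ + y ℤ.* + Q
  kx+1≡yQ = begin
    kx ℤ.+ 1ℤ          ≡⟨ cong (ℤ._+ 1ℤ) (trans (ℤP.*-comm (+ k) (+ x)) (sym (ℤP.pos-* x k))) ⟩
    + (x * k) ℤ.+ 1ℤ   ≡⟨ ℤP.pos-+ (x * k) 1 ⟨
    + (x * k + 1)      ≡⟨ cong +_ (trans (ℕP.+-comm (x * k) 1) eq) ⟩
    + (y * Q)          ≡⟨ ℤP.pos-* y Q ⟩
    + y ℤ.* + Q        ∎

-- Every prime power dividing n! divides kⁿ ∏ᵢ (1 + ik): for q ∣ k it
-- already divides kⁿ, and for q ∤ k the product is ≡ kⁿ M(M+1)⋯(M+n-1)
-- (mod q^e) with kM ≡ 1, which is divisible by n!.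
prime-power∣scaled-progression : ∀ k n q e → Prime q → q ^ e ∣ n ! → q ^ e ∣ k ^ n * progression k n
prime-power∣scaled-progression k n q e pq q^e∣n! with q ND.∣? k
... | yes q∣k = ND.∣m⇒∣m*n (progression k n)
  (ND.∣-trans (^-monoʳ-∣ q (factorial-valuation-bound pq n e q^e∣n!)) (^-monoˡ-∣ q∣k n))
... | no q∤k = ND.∣n⇒∣m*n (k ^ n) (ZS.∣⇒∣ᵤ q^e∣progression)
  where
  U = proj₁ (inverse-mod-prime-power pq q∤k e)
  Q = + (q ^ e)
  congruent : Q ZS.∣ (+ progression k n ℤ.- + (k ^ n * rising U n))
  congruent = progression≡rising Q k U (proj₂ (inverse-mod-prime-power pq q∤k e)) n
  Q∣rising : Q ZS.∣ + (k ^ n * rising U n)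
  Q∣rising = ZS.∣ᵤ⇒∣ (ND.∣n⇒∣m*n (k ^ n) (ND.∣-trans q^e∣n! (factorial∣rising U n)))
  q^e∣progression : Q ZS.∣ + progression k n
  q^e∣progression = subst (Q ZS.∣_)
    (ZSolver.solve 2 (λ a b → a ZSolver.:- b ZSolver.:+ b ZSolver.:= a) refl (+ progression k n) (+ (k ^ n * rising U n)))
    (ZS.∣m∣n⇒∣m+n congruent Q∣rising)

∣-from-prime-powers : ∀ m X → .{{NonZero m}} → (∀ q e → Prime q → q ^ e ∣ m → q ^ e ∣ X) → m ∣ X
∣-from-prime-powers m X hyp = subst (_∣ X) (sym (PrimeFactorisation.isFactorisation F))
  (peel (PrimeFactorisation.factors F) (PrimeFactorisation.factorsPrime F) X
    (λ q e pq d → hyp q e pq (subst (q ^ e ∣_) (sym (PrimeFactorisation.isFactorisation F)) d)))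
  where
  F = factorise m
  peel : ∀ qs → All Prime qs → ∀ X → (∀ q e → Prime q → q ^ e ∣ product qs → q ^ e ∣ X) → product qs ∣ X
  peel []       _          X h = ND.1∣ X
  peel (q ∷ qs) (pq ∷ pqs) X h with h q 1 pq (subst (_∣ q * product qs) (sym (ℕP.*-identityʳ q)) (ND.m∣m*n (product qs)))
  ... | divides X′ eq = subst (q * product qs ∣_) (trans (ℕP.*-comm q X′) (sym X≡X′q))
                          (ND.*-monoʳ-∣ q (peel qs pqs X′ h′))
    where
    X≡X′q : X ≡ X′ * q
    X≡X′q = trans eq (cong (X′ *_) (ℕP.*-identityʳ q))
    h′ : ∀ r e → Prime r → r ^ e ∣ product qs → r ^ e ∣ X′
    h′ r e pr d with r ℕP.≟ q
    ... | yes refl = ND.*-cancelʳ-∣ q {{prime⇒nonZero pq}}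
                       (subst₂ _∣_ (ℕP.*-comm q (q ^ e)) X≡X′q (h q (suc e) pq (ND.*-monoʳ-∣ q d)))
    ... | no r≢q = prime-power-cancel pr r∤q e (subst (r ^ e ∣_) (trans X≡X′q (ℕP.*-comm X′ q)) (h r e pr (ND.∣n⇒∣m*n q d)))
      where
      r∤q : ¬ r ∣ q
      r∤q r∣q with prime⇒irreducible pq r∣q
      ... | inj₁ r≡1 = ℕ.nonTrivial⇒≢1 {{prime⇒nonTrivial pr}} r≡1
      ... | inj₂ r≡q = r≢q r≡q

-- Integrality of c(n,k):  n! divides kⁿ ∏ᵢ (1 + ik).
factorial∣scaled-progression : ∀ k n → n ! ∣ k ^ n * progression k n
factorial∣scaled-progression k n =
  ∣-from-prime-powers (n !) _ {{n ℕP.!≢0}} (λ q e pq → prime-power∣scaled-progression k n q e pq)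

sumBelow-cong : ∀ D {f g : ℕ → ℕ} → (∀ j → f j ≡ g j) → sumBelow D f ≡ sumBelow D g
sumBelow-cong zero    f≗g = refl
sumBelow-cong (suc D) f≗g = cong₂ _+_ (sumBelow-cong D f≗g) (f≗g D)

sumBelow-* : ∀ D c g → sumBelow D (λ j → c * g j) ≡ c * sumBelow D g
sumBelow-* zero    c g = sym (ℕP.*-zeroʳ c)
sumBelow-* (suc D) c g = trans (cong (_+ c * g D) (sumBelow-* D c g)) (sym (ℕP.*-distribˡ-+ c (sumBelow D g) (g D)))

sumBelow-shift : ∀ D f → sumBelow (suc D) f ≡ f 0 + sumBelow D (λ j → f (suc j))
sumBelow-shift zero    f = sym (ℕP.+-identityʳ (f 0))
sumBelow-shift (suc D) f = trans (cong (_+ f (suc D)) (sumBelow-shift D f)) (ℕP.+-assoc (f 0) _ (f (suc D)))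

sumBelow-split : ∀ D E f → sumBelow (D + E) f ≡ sumBelow D f + sumBelow E (λ j → f (D + j))
sumBelow-split D zero    f = trans (cong (λ z → sumBelow z f) (ℕP.+-identityʳ D)) (sym (ℕP.+-identityʳ _))
sumBelow-split D (suc E) f = trans (cong (λ z → sumBelow z f) (ℕP.+-suc D E))
  (trans (cong (_+ f (D + E)) (sumBelow-split D E f)) (ℕP.+-assoc (sumBelow D f) _ (f (D + E))))

digits : ℕ → (ℕ → ℕ) → ℕ → ℕ
digits p a D = sumBelow D (λ j → a j * p ^ j)

digits-suc : ∀ p a D → digits p a (suc D) ≡ p * digits p (λ j → a (suc j)) D + a 0
digits-suc p a D = begin
  digits p a (suc D)                                     ≡⟨ sumBelow-shift D (λ j → a j * p ^ j) ⟩
  a 0 * 1 + sumBelow D (λ j → a (suc j) * (p * p ^ j))    ≡⟨ cong₂ _+_ (ℕP.*-identityʳ (a 0)) (sumBelow-cong D reassociate) ⟩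
  a 0 + sumBelow D (λ j → p * (a (suc j) * p ^ j))        ≡⟨ cong (_+_ (a 0)) (sumBelow-* D p _) ⟩
  a 0 + p * digits p (λ j → a (suc j)) D                  ≡⟨ ℕP.+-comm (a 0) _ ⟩
  p * digits p (λ j → a (suc j)) D + a 0                  ∎
  where
  open ≡-Reasoning
  reassociate : ∀ j → a (suc j) * (p * p ^ j) ≡ p * (a (suc j) * p ^ j)
  reassociate j = NS.solve 3 (λ x p y → x NS.:* (p NS.:* y) NS.:= p NS.:* (x NS.:* y)) refl (a (suc j)) p (p ^ j)

digits-split : ∀ p b D E → digits p b (D + E) ≡ digits p b D + p ^ D * digits p (λ j → b (D + j)) E
digits-split p b D E = trans (sumBelow-split D E (λ j → b j * p ^ j))
  (cong (_+_ (digits p b D)) (trans (sumBelow-cong E reassociate) (sumBelow-* E (p ^ D) _)))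
  where
  reassociate : ∀ j → b (D + j) * p ^ (D + j) ≡ p ^ D * (b (D + j) * p ^ j)
  reassociate j = trans (cong (b (D + j) *_) (ℕP.^-distribˡ-+-* p D j))
    (NS.solve 3 (λ x y z → x NS.:* (y NS.:* z) NS.:= y NS.:* (x NS.:* z)) refl (b (D + j)) (p ^ D) (p ^ j))

NoCarry : ℕ → (ℕ → ℕ) → (ℕ → ℕ) → ℕ → Set
NoCarry p a b D = ∀ j → j < D → a j + b j < p

no-carry-suc : ∀ {p a b} D → a 0 + b 0 < p →
  NoCarry p a b (suc D) ⇔ NoCarry p (λ j → a (suc j)) (λ j → b (suc j)) D
no-carry-suc {p} {a} {b} D first = mk⇔ (λ nc j j<D → nc (suc j) (s≤s j<D)) extend
  where
  extend : NoCarry p (λ j → a (suc j)) (λ j → b (suc j)) D → NoCarry p a b (suc D)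
  extend nc zero    _         = first
  extend nc (suc j) (s≤s j<D) = nc j j<D

-- One base-p digit of Kummer's theorem.  Write B = pB′ + β and n = pν + α
-- with digits α, β < p.  Then (B + n choose n) · U · p^(B′+ν) ν! B′! = (B + n)!
-- for a p-unit U; comparing with the splitting of (B + n)! shows that without
-- a carry (α + β < p) p divides (B + n choose n) iff it divides
-- (B′ + ν choose ν), while with a carry p always divides it.
module DigitStep {p} (pp : Prime p) (B′ ν β α : ℕ) (β<p : β < p) (α<p : α < p) where

  B = p * B′ + β
  n = p * ν + α
  binom = (B + n) C n
  binom′ = (B′ + ν) C ν
  P = p ^ (B′ + ν)
  F = ν ! * B′ !

  private
    splitB = factorial-split pp B′ β β<p
    splitn = factorial-split pp ν α α<p
    W₂ = proj₁ splitB
    W₃ = proj₁ splitn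
    instance
      PF≢0 : NonZero (P * F)
      PF≢0 = ℕP.m*n≢0 P F {{ℕP.m^n≢0 p (B′ + ν) {{prime⇒nonZero pp}}}} {{ν ℕP.!* B′ !≢0}}

  U = W₃ * W₂

  p∤U : ¬ p ∣ U
  p∤U = prime∤* pp (proj₁ (proj₂ splitn)) (proj₁ (proj₂ splitB))

  scaled-binomial : binom * U * (P * F) ≡ (B + n) !
  scaled-binomial = begin
    binom * U * (P * F)                                   ≡⟨ cong (λ x → binom * U * (x * F)) (ℕP.^-distribˡ-+-* p B′ ν) ⟩
    binom * (W₃ * W₂) * (p ^ B′ * p ^ ν * (ν ! * B′ !))    ≡⟨ NS.solve 7 (λ c w₃ w₂ x y f g →
                                                               c NS.:* (w₃ NS.:* w₂) NS.:* (x NS.:* y NS.:* (f NS.:* g))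
                                                               NS.:= c NS.:* ((y NS.:* f NS.:* w₃) NS.:* (x NS.:* g NS.:* w₂)))
                                                             refl binom W₃ W₂ (p ^ B′) (p ^ ν) (ν !) (B′ !) ⟩
    binom * ((p ^ ν * ν ! * W₃) * (p ^ B′ * B′ ! * W₂))    ≡⟨ cong₂ (λ x y → binom * (x * y)) (proj₂ (proj₂ splitn)) (proj₂ (proj₂ splitB)) ⟨
    binom * (n ! * B !)                                   ≡⟨ binomial-sum-identity B n ⟩
    (B + n) !                                             ∎
    where open ≡-Reasoning

  sum-digits : B + n ≡ p * (B′ + ν) + (β + α)
  sum-digits = NS.solve 5 (λ p x y b a → (p NS.:* x NS.:+ b) NS.:+ (p NS.:* y NS.:+ a)
                                        NS.:= p NS.:* (x NS.:+ y) NS.:+ (b NS.:+ a)) refl p B′ ν β α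

  no-carry : α + β < p → (p ∣ binom) ⇔ (p ∣ binom′)
  no-carry α+β<p = mk⇔
    (λ p∣binom → prime-cancel pp p∤W₁ (subst (p ∣_) (trans binom-relation (ℕP.*-comm binom′ W₁)) (ND.∣m⇒∣m*n U p∣binom)))
    (λ p∣binom′ → prime-cancel pp p∤U (subst (p ∣_) (trans (sym binom-relation) (ℕP.*-comm binom U)) (ND.∣m⇒∣m*n W₁ p∣binom′)))
    where
    split = factorial-split pp (B′ + ν) (β + α) (subst (_< p) (ℕP.+-comm α β) α+β<p)
    W₁ = proj₁ split
    p∤W₁ : ¬ p ∣ W₁
    p∤W₁ = proj₁ (proj₂ split)
    binom-relation : binom * U ≡ binom′ * W₁
    binom-relation = ℕP.*-cancelʳ-≡ _ _ (P * F) (begin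
      binom * U * (P * F)                ≡⟨ scaled-binomial ⟩
      (B + n) !                          ≡⟨ cong _! sum-digits ⟩
      (p * (B′ + ν) + (β + α)) !         ≡⟨ proj₂ (proj₂ split) ⟩
      P * (B′ + ν) ! * W₁                ≡⟨ cong (λ x → P * x * W₁) (binomial-sum-identity B′ ν) ⟨
      P * (binom′ * F) * W₁              ≡⟨ NS.solve 4 (λ x c f w → x NS.:* (c NS.:* f) NS.:* w NS.:= c NS.:* w NS.:* (x NS.:* f))
                                              refl P binom′ F W₁ ⟩
      binom′ * W₁ * (P * F)              ∎)
      where open ≡-Reasoning

  carry : p ≤ α + β → p ∣ binom
  carry p≤α+β = prime-cancel pp p∤U (subst (p ∣_) (trans (sym binom-relation) (ℕP.*-comm binom U)) (ND.m∣m*n _))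
    where
    p≤β+α = subst (p ≤_) (ℕP.+-comm α β) p≤α+β
    s = β + α ∸ p
    T = B′ + ν
    sum-digits′ : B + n ≡ p * suc T + s
    sum-digits′ = trans sum-digits (begin
      p * T + (β + α)        ≡⟨ cong (_+_ (p * T)) (ℕP.m+[n∸m]≡n p≤β+α) ⟨
      p * T + (p + s)        ≡⟨ NS.solve 3 (λ p t s → p NS.:* t NS.:+ (p NS.:+ s) NS.:= p NS.:* (NS.con 1 NS.:+ t) NS.:+ s) refl p T s ⟩
      p * suc T + s          ∎)
      where open ≡-Reasoning
    split = factorial-split pp (suc T) s
      (ℕP.+-cancelˡ-< p s p (subst (_< p + p) (sym (ℕP.m+[n∸m]≡n p≤β+α)) (ℕP.+-mono-< β<p α<p)))
    W₁ = proj₁ split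
    binom-relation : binom * U ≡ p * (suc T * binom′ * W₁)
    binom-relation = ℕP.*-cancelʳ-≡ _ _ (P * F) (begin
      binom * U * (P * F)                ≡⟨ scaled-binomial ⟩
      (B + n) !                          ≡⟨ cong _! sum-digits′ ⟩
      (p * suc T + s) !                  ≡⟨ proj₂ (proj₂ split) ⟩
      p * P * (suc T * T !) * W₁         ≡⟨ cong (λ x → p * P * (suc T * x) * W₁) (binomial-sum-identity B′ ν) ⟨
      p * P * (suc T * (binom′ * F)) * W₁ ≡⟨ NS.solve 6 (λ p x t c f w → p NS.:* x NS.:* (t NS.:* (c NS.:* f)) NS.:* w
                                                          NS.:= p NS.:* (t NS.:* c NS.:* w) NS.:* (x NS.:* f))
                                               refl p P (suc T) binom′ F W₁ ⟩
      p * (suc T * binom′ * W₁) * (P * F) ∎)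
      where open ≡-Reasoning

-- Kummer's theorem in the form needed here: if n has base-p digits
-- a 0 … a (D-1) and B has lowest base-p digits b 0 … b (D-1) (above which
-- it is arbitrary, p^D · R), then p ∤ (B + n choose n) iff no carry occurs
-- when adding the digits.
kummer : ∀ {p} → Prime p → (a b : ℕ → ℕ) → (∀ j → a j < p) → (∀ j → b j < p) → ∀ D R →
  (¬ p ∣ ((digits p b D + p ^ D * R + digits p a D) C digits p a D)) ⇔ NoCarry p a b D
kummer pp a b a<p b<p zero R = mk⇔ (λ _ j ()) (λ _ → prime∤1 pp)
kummer {p} pp a b a<p b<p (suc D) R = by-lowest-digit ((a 0 + b 0) ℕP.<? p)
  where
  a′ b′ : ℕ → ℕ
  a′ j = a (suc j)
  b′ j = b (suc j)
  module Step = DigitStep pp (digits p b′ D + p ^ D * R) (digits p a′ D) (b 0) (a 0) (b<p 0) (a<p 0)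
  B-digits : digits p b (suc D) + p ^ suc D * R ≡ Step.B
  B-digits = trans (cong (_+ p ^ suc D * R) (digits-suc p b D))
    (NS.solve 5 (λ p x b y r → p NS.:* x NS.:+ b NS.:+ p NS.:* y NS.:* r NS.:= p NS.:* (x NS.:+ y NS.:* r) NS.:+ b)
      refl p (digits p b′ D) (b 0) (p ^ D) R)
  binom≡ : ((digits p b (suc D) + p ^ suc D * R + digits p a (suc D)) C digits p a (suc D)) ≡ Step.binom
  binom≡ = cong₂ (λ x y → (x + y) C y) B-digits (digits-suc p a D)
  by-lowest-digit : Dec (a 0 + b 0 < p) →
    (¬ p ∣ ((digits p b (suc D) + p ^ suc D * R + digits p a (suc D)) C digits p a (suc D))) ⇔ NoCarry p a b (suc D)
  by-lowest-digit (yes no-carry₀) = begin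
    ¬ p ∣ _                         ≡⟨ cong (λ x → ¬ p ∣ x) binom≡ ⟩
    ¬ p ∣ Step.binom                ≈⟨ ¬-cong-⇔ (Step.no-carry no-carry₀) ⟩
    ¬ p ∣ Step.binom′               ≈⟨ kummer pp a′ b′ (λ j → a<p (suc j)) (λ j → b<p (suc j)) D R ⟩
    NoCarry p a′ b′ D               ≈⟨ no-carry-suc {p} {a} {b} D no-carry₀ ⟨
    NoCarry p a b (suc D)           ∎
    where open ⇔-Reasoning
  by-lowest-digit (no carry₀) = mk⇔
    (λ p∤binom → ⊥-elim (p∤binom (subst (p ∣_) (sym binom≡) (Step.carry (ℕP.≮⇒≥ carry₀)))))
    (λ no-carry → ⊥-elim (carry₀ (no-carry 0 (s≤s z≤n))))

-- If p^N divides z · n! with N > n, then p divides z, since v_p(n!) ≤ n.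
prime-power∣*factorial⇒∣ : ∀ {p} → Prime p → ∀ {z n N} → n < N → p ^ N ∣ z * n ! → p ∣ z
prime-power∣*factorial⇒∣ {p} pp {z} {n} {N} n<N p^N∣z*n! with p ND.∣? z
... | yes p∣z = p∣z
... | no  p∤z = ⊥-elim (ℕP.<⇒≱ n<N (factorial-valuation-bound pp n N (prime-power-cancel pp p∤z N p^N∣z*n!)))

congruent⇒∣⇔∣ : ∀ {p x y} → + p ZS.∣ (+ x ℤ.- + y) → p ∣ x ⇔ p ∣ y
congruent⇒∣⇔∣ {p} {x} {y} p∣x-y = mk⇔
  (λ p∣x → ZS.∣⇒∣ᵤ {+ p} {+ y} (subst (+ p ZS.∣_) (solve 2 (λ x y → x :- (x :- y) := y) refl (+ x) (+ y))
                                 (ZS.∣m∣n⇒∣m-n (ZS.∣ᵤ⇒∣ {+ p} {+ x} p∣x) p∣x-y)))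
  (λ p∣y → ZS.∣⇒∣ᵤ {+ p} {+ x} (subst (+ p ZS.∣_) (solve 2 (λ x y → (x :- y) :+ y := x) refl (+ x) (+ y))
                                 (ZS.∣m∣n⇒∣m+n p∣x-y (ZS.∣ᵤ⇒∣ {+ p} {+ y} p∣y))))
  where open ZSolver

unit-*-∣⇔∣ : ∀ {p u y} → Prime p → ¬ p ∣ u → p ∣ u * y ⇔ p ∣ y
unit-*-∣⇔∣ {u = u} pp p∤u = mk⇔ (prime-cancel pp p∤u) (ND.∣n⇒∣m*n u)

-- If k (1 + B) ≡ 1 (mod p^N) with N > n,
-- then ∏ᵢ (1 + ik) ≡ kⁿ (1 + B)⋯(B + n) = kⁿ n! (B + n choose n)  (mod p^N),
-- so c(n,k) ≡ k²ⁿ (B + n choose n) (mod p) and, as p ∤ k,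
-- p divides c(n,k) exactly when it divides (B + n choose n).
scaled-progression⇔binomial : ∀ {p k} → Prime p → ¬ p ∣ k → ∀ n N B → n < N →
  + (p ^ N) ZS.∣ (+ k ℤ.* + (1 + B) ℤ.- 1ℤ) →
  (p * n ! ∣ k ^ n * progression k n) ⇔ (p ∣ (B + n) C n)
scaled-progression⇔binomial {p} {k} pp p∤k n N B n<N k[1+B]≡1 = via-c′
  where
  binom = (B + n) C n
  kⁿ = k ^ n
  -- c′ is c(n,k) as a natural number
  c′ = ND.quotient (factorial∣scaled-progression k n)
  X≡c′n! : kⁿ * progression k n ≡ c′ * n !
  X≡c′n! = ND._∣_.equality (factorial∣scaled-progression k n)
  difference = + c′ ℤ.- + (kⁿ * kⁿ * binom)
  difference*n! : + kⁿ ℤ.* (+ progression k n ℤ.- + (kⁿ * rising (suc B) n)) ≡ difference ℤ.* + (n !)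
  difference*n! = begin
    + kⁿ ℤ.* (+ progression k n ℤ.- + (kⁿ * rising (suc B) n))
      ≡⟨ ZSolver.solve 3 (λ a b c → a ZSolver.:* (b ZSolver.:- c) ZSolver.:= a ZSolver.:* b ZSolver.:- a ZSolver.:* c)
                         refl (+ kⁿ) (+ progression k n) (+ (kⁿ * rising (suc B) n)) ⟩
    + kⁿ ℤ.* + progression k n ℤ.- + kⁿ ℤ.* + (kⁿ * rising (suc B) n)
      ≡⟨ cong₂ ℤ._-_ (ℤP.pos-* kⁿ (progression k n)) (ℤP.pos-* kⁿ _) ⟨
    + (kⁿ * progression k n) ℤ.- + (kⁿ * (kⁿ * rising (suc B) n))
      ≡⟨ cong₂ (λ x y → + x ℤ.- + y) X≡c′n! (cong (λ r → kⁿ * (kⁿ * r)) (rising-binomial B n)) ⟩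
    + (c′ * n !) ℤ.- + (kⁿ * (kⁿ * (binom * n !)))
      ≡⟨ cong (λ x → + (c′ * n !) ℤ.- + x) (ℕP.*-assoc kⁿ kⁿ (binom * n !)) ⟨
    + (c′ * n !) ℤ.- + (kⁿ * kⁿ * (binom * n !))
      ≡⟨ cong (λ x → + (c′ * n !) ℤ.- + x) (ℕP.*-assoc (kⁿ * kⁿ) binom (n !)) ⟨
    + (c′ * n !) ℤ.- + (kⁿ * kⁿ * binom * n !)
      ≡⟨ cong₂ ℤ._-_ (ℤP.pos-* c′ (n !)) (ℤP.pos-* (kⁿ * kⁿ * binom) (n !)) ⟩
    + c′ ℤ.* + (n !) ℤ.- + (kⁿ * kⁿ * binom) ℤ.* + (n !)
      ≡⟨ ZSolver.solve 3 (λ f a b → a ZSolver.:* f ZSolver.:- b ZSolver.:* f ZSolver.:= (a ZSolver.:- b) ZSolver.:* f)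
                         refl (+ (n !)) (+ c′) (+ (kⁿ * kⁿ * binom)) ⟩
    difference ℤ.* + (n !) ∎
    where open ≡-Reasoning
  p^N∣difference*n! : p ^ N ∣ ℤ.∣ difference ∣ * n !
  p^N∣difference*n! = subst (p ^ N ∣_) (ℤP.abs-* difference (+ (n !)))
    (ZS.∣⇒∣ᵤ (subst (+ (p ^ N) ZS.∣_) difference*n!
      (ZS.∣n⇒∣m*n (+ kⁿ) (progression≡rising (+ (p ^ N)) k (suc B) k[1+B]≡1 n))))
  p∣c′-k²ⁿbinom : + p ZS.∣ difference
  p∣c′-k²ⁿbinom = ZS.∣ᵤ⇒∣ (prime-power∣*factorial⇒∣ pp n<N p^N∣difference*n!)
  via-c′ : (p * n ! ∣ kⁿ * progression k n) ⇔ (p ∣ binom)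
  via-c′ = begin
    p * n ! ∣ kⁿ * progression k n ≡⟨ cong (p * n ! ∣_) X≡c′n! ⟩
    p * n ! ∣ c′ * n !             ≈⟨ mk⇔ (ND.*-cancelʳ-∣ (n !) {{n ℕP.!≢0}}) (ND.*-monoˡ-∣ (n !)) ⟩
    p ∣ c′                         ≈⟨ congruent⇒∣⇔∣ p∣c′-k²ⁿbinom ⟩
    p ∣ kⁿ * kⁿ * binom            ≈⟨ unit-*-∣⇔∣ pp (prime∤* pp (prime∤^ pp p∤k n) (prime∤^ pp p∤k n)) ⟩
    p ∣ binom                      ∎
    where open ⇔-Reasoning

theorem3p2 : (k : ℕ) .{{_ : NonZero k}} (p : ℕ) → Prime p → ¬ (p ND.∣ k) →
    (n d : ℕ) (a : ℕ → ℕ) → (∀ j → a j < p) →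
    n ≡ sumBelow (ℕ.suc d) (λ j → a j * p ^ j) →
    (b : ℕ → ℕ) → (∀ j → b j < p) →
    (∀ N → (+ (p ^ N)) ZD.∣ ((+ k) ℤ.* (+ (1 + sumBelow N (λ j → b j * p ^ j))) ℤ.- (+ 1))) →
    (¬ (∃ λ (m : ℤ) → c n k ≡ (ℤ.+ p ℚ./ 1) ℚ.* (m ℚ./ 1)))
      ⇔ (∀ j → j ≤ d → a j + b j < p)
theorem3p2 k p pp p∤k n d a a<p n≡digits b b<p k[1+B]≡1 = begin
  ¬ (∃ λ m → c n k ≡ toℚ (+ p) ℚ.* toℚ m)    ≈⟨ ¬-cong-⇔ (c-multiple⇔ n k p) ⟩
  ¬ (p * n ! ∣ k ^ n * progression k n)       ≈⟨ ¬-cong-⇔ (scaled-progression⇔binomial pp p∤k n N B n<N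
                                                             (ZS.∣ᵤ⇒∣ (k[1+B]≡1 N))) ⟩
  ¬ (p ∣ (B + n) C n)                         ≡⟨ cong₂ (λ x y → ¬ (p ∣ (x + y) C y)) B-digits n≡digits ⟩
  ¬ (p ∣ (B′ + digits p a D) C digits p a D)  ≈⟨ kummer pp a b a<p b<p D R ⟩
  NoCarry p a b D                             ≈⟨ mk⇔ (λ nc j j≤d → nc j (s≤s j≤d)) (λ h j j<D → h j (ℕP.≤-pred j<D)) ⟩
  (∀ j → j ≤ d → a j + b j < p)               ∎
  where
  open ⇔-Reasoning
  -- n has the D = d + 1 digits a; B is the truncation at N = D + n + 1 > n of the
  -- p-adic expansion of 1/k - 1, whose lowest D digits are those of b.
  D = suc d
  N = D + suc n
  n<N : n < N
  n<N = ℕP.m≤n+m (suc n) D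
  B = digits p b N
  R = digits p (λ j → b (D + j)) (suc n)
  B′ = digits p b D + p ^ D * R
  B-digits : B ≡ B′
  B-digits = digits-split p b D (suc n)
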